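{- There exist non-crossing closed knight's tours in the following cuboids: - a closed tour of length $4$ in the $2\times 2\times 3$ cuboid; - a closed tour of length $8$ in the $2\times 3\times 3$ cuboid. There exist non-crossing knight's paths in the following cuboids: - a path of length $14$ in the $2\times 4\times 4$ cuboid; - a path of length $20$ in the $3\times 3\times 4$ cuboid; - a path of length $27$ in the $3\times 4\times 4$ cuboid.
   Context: An $a\times b\times c$ cuboid is the set of cells $B=\{0,\dots,a-1\}\times\{0,\dots,b-1\}\times\{0,\dots,c-1\}\subset\mathbb{Z}^3$. Each cell is identified with its centre, a point of $\mathbb{R}^3$. A (three-dimensional) knight move from cell $u$ to cell $v$ is allowed when the multiset of absolute values of the coordinates of $v-u$ is $\{0,1,2\}$. A non-crossing knight's path of length $L$ in $B$ is a sequence of cells $v_0,v_1,\dots,v_L\in B$ with the following properties: - the $v_i$ are pairwise distinct; - each step from $v_{i-1}$ to $v_i$ is a knight move; - the straight closed segments $s_i=[v_{i-1},v_i]\subset\mathbb{R}^3$ ($1\le i\le L$) satisfy two conditions. First, consecutive segments meet only at their common endpoint. Second, non-consecutive segments are disjoint. A non-crossing closed knight's tour of length $L$ in $B$ is a sequence of cells $v_0,\dots,v_{L-1},v_L=v_0$ with the following properties: - $v_0,\dots,v_{L-1}$ are pairwise distinct; - each step from $v_{i-1}$ to $v_i$ ($1\le i\le L$) is a knight move; - the segments $s_i=[v_{i-1},v_i]$, with indices taken cyclically modulo $L$, satisfy two conditions. First, cyclically consecutive segments meet only at their common endpoint. Second, cyclically non-consecutive segments are disjoint. The length is the number of moves 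$L$.
   Formalization: The non-crossing conditions on the segments $s_i$ are tested only at points with rational coordinates, at a rational position along each segment, rather than at all points of $\mathbb{R}^3$. -}

module Defs where

open import Data.Nat as ℕ using (ℕ; zero; suc; ∣_-_∣)
open import Data.Integer using (+_)
open import Data.Rational as ℚ using (ℚ; 0ℚ; 1ℚ; _/_)
open import Data.Product using (Σ; ∃; _×_; _,_)
open import Data.Sum using (_⊎_)
open import Data.List using (List; _∷_; [])
open import Data.List.Relation.Binary.Permutation.Propositional using (_↭_)
open import Relation.Binary.PropositionalEquality using (_≡_; _≢_)
open import Relation.Nullary using (¬_)

-- A cell of ℤ³ with non-negative coordinates (all cells of a cuboid are such).
Cell : Set
Cell = ℕ × ℕ × ℕ

InBox : ℕ → ℕ → ℕ → Cell → Set
InBox a b c (x , y , z) = (x ℕ.< a) × (y ℕ.< b) × (z ℕ.< c)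

KnightMove : Cell → Cell → Set
KnightMove (x , y , z) (x' , y' , z') =
  (∣ x - x' ∣ ∷ ∣ y - y' ∣ ∷ ∣ z - z' ∣ ∷ []) ↭ (0 ∷ 1 ∷ 2 ∷ [])

Point : Set
Point = ℚ × ℚ × ℚ

toℚ : ℕ → ℚ
toℚ n = (+ n) / 1

centre : Cell → Point
centre (x , y , z) = toℚ x , toℚ y , toℚ z

OnSeg : Cell → Cell → Point → Set
OnSeg u v p =
  let (ux , uy , uz) = centre u
      (vx , vy , vz) = centre v
      (px , py , pz) = p
  in Σ ℚ λ t → (0ℚ ℚ.≤ t) × (t ℚ.≤ 1ℚ) ×
       (px ≡ ux ℚ.+ t ℚ.* (vx ℚ.- ux)) ×
       (py ≡ uy ℚ.+ t ℚ.* (vy ℚ.- uy)) ×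
       (pz ≡ uz ℚ.+ t ℚ.* (vz ℚ.- uz))

OnSegOf : (ℕ → Cell) → ℕ → Point → Set
OnSegOf v i = OnSeg (v i) (v (suc i))

MeetOnlyAt : (ℕ → Cell) → ℕ → ℕ → Cell → Set
MeetOnlyAt v i j w = ∀ p → OnSegOf v i p → OnSegOf v j p → p ≡ centre w

Disjoint : (ℕ → Cell) → ℕ → ℕ → Set
Disjoint v i j = ∀ p → OnSegOf v i p → ¬ OnSegOf v j p

-- non-crossing knight's path v 0, …, v L of length L in the a×b×c cuboid
IsNCPath : ℕ → ℕ → ℕ → ℕ → (ℕ → Cell) → Set
IsNCPath a b c L v =
  (∀ i → i ℕ.≤ L → InBox a b c (v i)) ×
  (∀ i j → i ℕ.≤ L → j ℕ.≤ L → v i ≡ v j → i ≡ j) ×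
  (∀ i → i ℕ.< L → KnightMove (v i) (v (suc i))) ×
  (∀ i → suc i ℕ.< L → MeetOnlyAt v i (suc i) (v (suc i))) ×
  (∀ i j → suc i ℕ.< j → j ℕ.< L → Disjoint v i j)

NCPath : ℕ → ℕ → ℕ → ℕ → Set
NCPath a b c L = Σ (ℕ → Cell) (IsNCPath a b c L)

CycNext : ℕ → ℕ → ℕ → Set
CycNext L i j = (suc i ≡ j) ⊎ ((suc i ≡ L) × (j ≡ 0))

-- non-crossing closed knight's tour v 0, …, v (L-1), v L = v 0 of length L
IsNCTour : ℕ → ℕ → ℕ → ℕ → (ℕ → Cell) → Set
IsNCTour a b c L v =
  (∀ i → i ℕ.< L → InBox a b c (v i)) ×
  (v L ≡ v 0) ×
  (∀ i j → i ℕ.< L → j ℕ.< L → v i ≡ v j → i ≡ j) ×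
  (∀ i → i ℕ.< L → KnightMove (v i) (v (suc i))) ×
  (∀ i j → i ℕ.< L → j ℕ.< L → CycNext L i j → MeetOnlyAt v i j (v (suc i))) ×
  (∀ i j → i ℕ.< L → j ℕ.< L → i ≢ j → ¬ CycNext L i j → ¬ CycNext L j i →
     Disjoint v i j)

NCTour : ℕ → ℕ → ℕ → ℕ → Set
NCTour a b c L = Σ (ℕ → Cell) (IsNCTour a b c L)

-- Each claim is witnessed by an explicit vertex sequence; box membership, distinctness and
-- the knight moves are finite checks. Under a linear functional f, a point of a segment
-- [u, v] takes a value between f u and f v. Hence two segments are disjoint as soon as some
-- f is smaller at both ends of one than at both ends of the other, and consecutive segments
-- [a, b], [b, d] meet only in b as soon as some f has f a ≤ f b < f d. Integer functionals
-- with coefficients in {-2, …, 2} do this for every relevant pair of segments, and the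
-- search for them is carried out by evaluation.

module Submission where

open import Defs
open import Data.Nat using (ℕ; zero; suc; ∣_-_∣; s≤s)
import Data.Nat as ℕ
import Data.Nat.Properties as ℕ
open import Data.Integer as ℤ using (ℤ; +_; -[1+_]; _⊔_; _⊓_)
import Data.Integer.Properties as ℤ
open import Data.Rational
  using (ℚ; 0ℚ; 1ℚ; _/_; toℚᵘ; _+_; _*_; _-_; -_; _≤_; _<_; nonNegative; nonPositive; positive)
open import Data.Rational.Properties
import Data.Rational.Unnormalised as ℚᵘ
import Data.Rational.Unnormalised.Properties as ℚᵘ
open import Data.Product using (_×_; _,_)
open import Data.Product.Properties using (≡-dec)
open import Data.Sum using (inj₁; inj₂)
open import Data.Maybe using (Maybe; just; nothing)
open import Data.List using (List; []; _∷_; cartesianProduct)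
open import Data.List.Relation.Unary.Any using (Any; here; there; any?; satisfied)
open import Data.List.Relation.Binary.Permutation.Propositional
  using (_↭_; prep; swap) renaming (refl to ↭-refl; trans to ↭-trans)
open import Relation.Binary using (DecidableEquality)
open import Relation.Nullary using (¬_; Dec; yes; no; map′; ¬?; _×-dec_; _⊎-dec_; _→-dec_)
open import Relation.Nullary.Decidable using (True; toWitness)
open import Relation.Binary.PropositionalEquality
open import Tactic.RingSolver using (solve-∀)
open import Tactic.RingSolver.Core.AlmostCommutativeRing using (AlmostCommutativeRing; fromCommutativeRing)

fromℤ : ℤ → ℚ
fromℤ i = i / 1

toℚᵘ-fromℤ : ∀ i → toℚᵘ (fromℤ i) ℚᵘ.≃ ℚᵘ.mkℚᵘ i 0
toℚᵘ-fromℤ i = toℚᵘ-fromℚᵘ (ℚᵘ.mkℚᵘ i 0)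

fromℤ-homo-+ : ∀ i j → fromℤ (i ℤ.+ j) ≡ fromℤ i + fromℤ j
fromℤ-homo-+ i j = toℚᵘ-injective (begin
  toℚᵘ (fromℤ (i ℤ.+ j))                ≈⟨ toℚᵘ-fromℤ (i ℤ.+ j) ⟩
  ℚᵘ.mkℚᵘ (i ℤ.+ j) 0                  ≈⟨ ℚᵘ.*≡* (cong (ℤ._* ℤ.1ℤ) (sym (cong₂ ℤ._+_ (ℤ.*-identityʳ i)
                                                                              (ℤ.*-identityʳ j)))) ⟩
  ℚᵘ.mkℚᵘ i 0 ℚᵘ.+ ℚᵘ.mkℚᵘ j 0         ≈⟨ ℚᵘ.+-cong (toℚᵘ-fromℤ i) (toℚᵘ-fromℤ j) ⟨
  toℚᵘ (fromℤ i) ℚᵘ.+ toℚᵘ (fromℤ j)   ≈⟨ toℚᵘ-homo-+ (fromℤ i) (fromℤ j) ⟨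
  toℚᵘ (fromℤ i + fromℤ j)             ∎)
  where open import Relation.Binary.Reasoning.Setoid ℚᵘ.≃-setoid

fromℤ-homo-* : ∀ i j → fromℤ (i ℤ.* j) ≡ fromℤ i * fromℤ j
fromℤ-homo-* i j = toℚᵘ-injective (begin
  toℚᵘ (fromℤ (i ℤ.* j))                ≈⟨ toℚᵘ-fromℤ (i ℤ.* j) ⟩
  ℚᵘ.mkℚᵘ i 0 ℚᵘ.* ℚᵘ.mkℚᵘ j 0         ≈⟨ ℚᵘ.*-cong (toℚᵘ-fromℤ i) (toℚᵘ-fromℤ j) ⟨
  toℚᵘ (fromℤ i) ℚᵘ.* toℚᵘ (fromℤ j)   ≈⟨ toℚᵘ-homo-* (fromℤ i) (fromℤ j) ⟨
  toℚᵘ (fromℤ i * fromℤ j)             ∎)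
  where open import Relation.Binary.Reasoning.Setoid ℚᵘ.≃-setoid

fromℤ-mono-≤ : ∀ {i j} → i ℤ.≤ j → fromℤ i ≤ fromℤ j
fromℤ-mono-≤ {i} {j} i≤j = toℚᵘ-cancel-≤
  (ℚᵘ.≤-respˡ-≃ (ℚᵘ.≃-sym (toℚᵘ-fromℤ i)) (ℚᵘ.≤-respʳ-≃ (ℚᵘ.≃-sym (toℚᵘ-fromℤ j))
    (ℚᵘ.*≤* (subst₂ ℤ._≤_ (sym (ℤ.*-identityʳ i)) (sym (ℤ.*-identityʳ j)) i≤j))))

fromℤ-mono-< : ∀ {i j} → i ℤ.< j → fromℤ i < fromℤ j
fromℤ-mono-< {i} {j} i<j = toℚᵘ-cancel-<
  (ℚᵘ.<-respˡ-≃ (ℚᵘ.≃-sym (toℚᵘ-fromℤ i)) (ℚᵘ.<-respʳ-≃ (ℚᵘ.≃-sym (toℚᵘ-fromℤ j))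
    (ℚᵘ.*<* (subst₂ ℤ._<_ (sym (ℤ.*-identityʳ i)) (sym (ℤ.*-identityʳ j)) i<j))))

ℚ-ring : AlmostCommutativeRing _ _
ℚ-ring = fromCommutativeRing +-*-commutativeRing 0≟
  where
  0≟ : ∀ x → Maybe (0ℚ ≡ x)
  0≟ x with 0ℚ ≟ x
  ... | yes 0≡x = just 0≡x
  ... | no  _   = nothing

p≤q⇒0≤q-p : ∀ {p q} → p ≤ q → 0ℚ ≤ q - p
p≤q⇒0≤q-p {p} {q} p≤q = subst (_≤ q - p) (+-inverseʳ p) (+-monoˡ-≤ (- p) p≤q)

p≤q⇒p-q≤0 : ∀ {p q} → p ≤ q → p - q ≤ 0ℚ
p≤q⇒p-q≤0 {p} {q} p≤q = subst (p - q ≤_) (+-inverseʳ q) (+-monoˡ-≤ (- q) p≤q)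

p<q⇒0<q-p : ∀ {p q} → p < q → 0ℚ < q - p
p<q⇒0<q-p {p} {q} p<q = subst (_< q - p) (+-inverseʳ p) (+-monoˡ-< (- p) p<q)

Functional : Set
Functional = ℤ × ℤ × ℤ

_·_ : Functional → Point → ℚ
(a , b , c) · (x , y , z) = fromℤ a * x + fromℤ b * y + fromℤ c * z

_·ᶜ_ : Functional → Cell → ℤ
(a , b , c) ·ᶜ (x , y , z) = a ℤ.* + x ℤ.+ b ℤ.* + y ℤ.+ c ℤ.* + z

·-centre : ∀ f u → f · centre u ≡ fromℤ (f ·ᶜ u)
·-centre (a , b , c) (x , y , z) = sym (begin
  fromℤ (a ℤ.* + x ℤ.+ b ℤ.* + y ℤ.+ c ℤ.* + z)
    ≡⟨ fromℤ-homo-+ (a ℤ.* + x ℤ.+ b ℤ.* + y) (c ℤ.* + z) ⟩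
  fromℤ (a ℤ.* + x ℤ.+ b ℤ.* + y) + fromℤ (c ℤ.* + z)
    ≡⟨ cong₂ _+_ (fromℤ-homo-+ (a ℤ.* + x) (b ℤ.* + y)) (fromℤ-homo-* c (+ z)) ⟩
  fromℤ (a ℤ.* + x) + fromℤ (b ℤ.* + y) + fromℤ c * toℚ z
    ≡⟨ cong (_+ fromℤ c * toℚ z) (cong₂ _+_ (fromℤ-homo-* a (+ x)) (fromℤ-homo-* b (+ y))) ⟩
  fromℤ a * toℚ x + fromℤ b * toℚ y + fromℤ c * toℚ z ∎)
  where open ≡-Reasoning

·-onSeg : ∀ f u v {p} ((t , _) : OnSeg u v p) →
          f · p ≡ f · centre u + t * (f · centre v - f · centre u)
·-onSeg (a , b , c) (ux , uy , uz) (vx , vy , vz) (t , _ , _ , refl , refl , refl) =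
  affine (fromℤ a) (fromℤ b) (fromℤ c) (toℚ ux) (toℚ uy) (toℚ uz) (toℚ vx) (toℚ vy) (toℚ vz) t
  where
  affine : ∀ a b c ux uy uz vx vy vz t →
    a * (ux + t * (vx - ux)) + b * (uy + t * (vy - uy)) + c * (uz + t * (vz - uz))
      ≡ (a * ux + b * uy + c * uz) + t * ((a * vx + b * vy + c * vz) - (a * ux + b * uy + c * uz))
  affine = solve-∀ ℚ-ring

affine-at-0 : ∀ A B → A + 0ℚ * (B - A) ≡ A
affine-at-0 = solve-∀ ℚ-ring

affine-at-1 : ∀ A B → A + 1ℚ * (B - A) ≡ B
affine-at-1 = solve-∀ ℚ-ring

module _ {A B t : ℚ} (0≤t : 0ℚ ≤ t) (t≤1 : t ≤ 1ℚ) where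
  open ≤-Reasoning

  affine-≤ : ∀ {M} → A ≤ M → B ≤ M → A + t * (B - A) ≤ M
  affine-≤ {M} A≤M B≤M with ≤-total A B
  ... | inj₁ A≤B = begin
    A + t * (B - A)   ≤⟨ +-monoʳ-≤ A (*-monoʳ-≤-nonNeg (B - A) {{nonNegative (p≤q⇒0≤q-p A≤B)}} t≤1) ⟩
    A + 1ℚ * (B - A)  ≡⟨ affine-at-1 A B ⟩
    B                 ≤⟨ B≤M ⟩
    M                 ∎
  ... | inj₂ B≤A = begin
    A + t * (B - A)   ≤⟨ +-monoʳ-≤ A (*-monoʳ-≤-nonPos (B - A) {{nonPositive (p≤q⇒p-q≤0 B≤A)}} 0≤t) ⟩
    A + 0ℚ * (B - A)  ≡⟨ affine-at-0 A B ⟩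
    A                 ≤⟨ A≤M ⟩
    M                 ∎

  affine-≥ : ∀ {m} → m ≤ A → m ≤ B → m ≤ A + t * (B - A)
  affine-≥ {m} m≤A m≤B with ≤-total A B
  ... | inj₁ A≤B = begin
    m                 ≤⟨ m≤A ⟩
    A                 ≡⟨ affine-at-0 A B ⟨
    A + 0ℚ * (B - A)  ≤⟨ +-monoʳ-≤ A (*-monoʳ-≤-nonNeg (B - A) {{nonNegative (p≤q⇒0≤q-p A≤B)}} 0≤t) ⟩
    A + t * (B - A)   ∎
  ... | inj₂ B≤A = begin
    m                 ≤⟨ m≤B ⟩
    B                 ≡⟨ affine-at-1 A B ⟨
    A + 1ℚ * (B - A)  ≤⟨ +-monoʳ-≤ A (*-monoʳ-≤-nonPos (B - A) {{nonPositive (p≤q⇒p-q≤0 B≤A)}} t≤1) ⟩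
    A + t * (B - A)   ∎

  affine-≤-start⇒t≡0 : A < B → A + t * (B - A) ≤ A → t ≡ 0ℚ
  affine-≤-start⇒t≡0 A<B stays = ≤-antisym (≮⇒≥ λ 0<t → <-irrefl refl (begin-strict
    A                 ≡⟨ affine-at-0 A B ⟨
    A + 0ℚ * (B - A)  <⟨ +-monoʳ-< A (*-monoˡ-<-pos (B - A) {{positive (p<q⇒0<q-p A<B)}} 0<t) ⟩
    A + t * (B - A)   ≤⟨ stays ⟩
    A                 ∎)) 0≤t

module _ (f : Functional) (u v : Cell) {p : Point} where
  open ≤-Reasoning

  onSeg-≤ : ∀ {k} → OnSeg u v p → f ·ᶜ u ℤ.≤ k → f ·ᶜ v ℤ.≤ k → f · p ≤ fromℤ k
  onSeg-≤ {k} p∈uv@(t , 0≤t , t≤1 , _) u≤k v≤k = begin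
    f · p                                             ≡⟨ ·-onSeg f u v p∈uv ⟩
    f · centre u + t * (f · centre v - f · centre u)  ≤⟨ affine-≤ 0≤t t≤1 (atCentre u≤k) (atCentre v≤k) ⟩
    fromℤ k                                           ∎
    where
    atCentre : ∀ {w} → f ·ᶜ w ℤ.≤ k → f · centre w ≤ fromℤ k
    atCentre {w} w≤k = subst (_≤ fromℤ k) (sym (·-centre f w)) (fromℤ-mono-≤ w≤k)

  onSeg-≥ : ∀ {k} → OnSeg u v p → k ℤ.≤ f ·ᶜ u → k ℤ.≤ f ·ᶜ v → fromℤ k ≤ f · p
  onSeg-≥ {k} p∈uv@(t , 0≤t , t≤1 , _) k≤u k≤v = begin
    fromℤ k                                           ≤⟨ affine-≥ 0≤t t≤1 (atCentre k≤u) (atCentre k≤v) ⟩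
    f · centre u + t * (f · centre v - f · centre u)  ≡⟨ ·-onSeg f u v p∈uv ⟨
    f · p                                             ∎
    where
    atCentre : ∀ {w} → k ℤ.≤ f ·ᶜ w → fromℤ k ≤ f · centre w
    atCentre {w} k≤w = subst (fromℤ k ≤_) (sym (·-centre f w)) (fromℤ-mono-≤ k≤w)

SeparatedBy : Functional → Cell → Cell → Cell → Cell → Set
SeparatedBy f a b c d = f ·ᶜ a ⊔ f ·ᶜ b ℤ.< f ·ᶜ c ⊓ f ·ᶜ d

separated⇒disjoint : ∀ f {a b c d} → SeparatedBy f a b c d → ∀ p → OnSeg a b p → ¬ OnSeg c d p
separated⇒disjoint f {a} {b} {c} {d} sep p p∈ab p∈cd = <-irrefl refl (begin-strict
  f · p                      ≤⟨ onSeg-≤ f a b p∈ab (ℤ.i≤i⊔j _ _) (ℤ.i≤j⊔i _ _) ⟩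
  fromℤ (f ·ᶜ a ⊔ f ·ᶜ b)    <⟨ fromℤ-mono-< sep ⟩
  fromℤ (f ·ᶜ c ⊓ f ·ᶜ d)    ≤⟨ onSeg-≥ f c d p∈cd (ℤ.i⊓j≤i _ _) (ℤ.i⊓j≤j _ _) ⟩
  f · p                      ∎)
  where open ≤-Reasoning

AdvancesBy : Functional → Cell → Cell → Cell → Set
AdvancesBy f a b d = f ·ᶜ a ℤ.≤ f ·ᶜ b × f ·ᶜ b ℤ.< f ·ᶜ d

advancesBy⇒meetOnlyAt : ∀ f {a b d} → AdvancesBy f a b d →
                        ∀ p → OnSeg a b p → OnSeg b d p → p ≡ centre b
advancesBy⇒meetOnlyAt f {a} {b@(bx , by , bz)} {d@(dx , dy , dz)} (a≤b , b<d) p p∈ab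
                      p∈bd@(s , 0≤s , s≤1 , refl , refl , refl) =
  atStart s (affine-≤-start⇒t≡0 0≤s s≤1 b<d′ stays)
  where
  open ≤-Reasoning
  b<d′ : f · centre b < f · centre d
  b<d′ = subst₂ _<_ (sym (·-centre f b)) (sym (·-centre f d)) (fromℤ-mono-< b<d)
  stays : f · centre b + s * (f · centre d - f · centre b) ≤ f · centre b
  stays = begin
    f · centre b + s * (f · centre d - f · centre b)  ≡⟨ ·-onSeg f b d p∈bd ⟨
    f · p                                             ≤⟨ onSeg-≤ f a b p∈ab a≤b ℤ.≤-refl ⟩
    fromℤ (f ·ᶜ b)                                    ≡⟨ ·-centre f b ⟨
    f · centre b                                      ∎
  atStart : ∀ s → s ≡ 0ℚ →
            (toℚ bx + s * (toℚ dx - toℚ bx) , toℚ by + s * (toℚ dy - toℚ by) , toℚ bz + s * (toℚ dz - toℚ bz))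
              ≡ centre b
  atStart _ refl = cong₂ _,_ (affine-at-0 (toℚ bx) (toℚ dx))
                             (cong₂ _,_ (affine-at-0 (toℚ by) (toℚ dy)) (affine-at-0 (toℚ bz) (toℚ dz)))

_≟ᶜ_ : DecidableEquality Cell
_≟ᶜ_ = ≡-dec ℕ._≟_ (≡-dec ℕ._≟_ ℕ._≟_)

open import Data.List.Membership.DecPropositional _≟ᶜ_ using (_∈_; _∈?_)

knightOffsets : List (ℕ × ℕ × ℕ)
knightOffsets = (0 , 1 , 2) ∷ (0 , 2 , 1) ∷ (1 , 0 , 2) ∷ (1 , 2 , 0) ∷ (2 , 0 , 1) ∷ (2 , 1 , 0) ∷ []

KnightStep : Cell → Cell → Set
KnightStep (x , y , z) (x′ , y′ , z′) = (∣ x - x′ ∣ , ∣ y - y′ ∣ , ∣ z - z′ ∣) ∈ knightOffsets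

knightStep? : ∀ u w → Dec (KnightStep u w)
knightStep? (x , y , z) (x′ , y′ , z′) = (∣ x - x′ ∣ , ∣ y - y′ ∣ , ∣ z - z′ ∣) ∈? knightOffsets

∈knightOffsets⇒↭ : ∀ {x y z} → (x , y , z) ∈ knightOffsets → (x ∷ y ∷ z ∷ []) ↭ (0 ∷ 1 ∷ 2 ∷ [])
∈knightOffsets⇒↭ (here refl) = ↭-refl
∈knightOffsets⇒↭ (there (here refl)) = prep 0 (swap 2 1 ↭-refl)
∈knightOffsets⇒↭ (there (there (here refl))) = swap 1 0 ↭-refl
∈knightOffsets⇒↭ (there (there (there (here refl)))) = ↭-trans (prep 1 (swap 2 0 ↭-refl)) (swap 1 0 ↭-refl)
∈knightOffsets⇒↭ (there (there (there (there (here refl))))) = ↭-trans (swap 2 0 ↭-refl) (prep 0 (swap 2 1 ↭-refl))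
∈knightOffsets⇒↭ (there (there (there (there (there (here refl)))))) =
  ↭-trans (swap 2 1 ↭-refl) (↭-trans (prep 1 (swap 2 0 ↭-refl)) (swap 1 0 ↭-refl))

knightStep⇒knightMove : ∀ u w → KnightStep u w → KnightMove u w
knightStep⇒knightMove (x , y , z) (x′ , y′ , z′) = ∈knightOffsets⇒↭

box : List Functional
box = cartesianProduct range (cartesianProduct range range)
  where range = -[1+ 1 ] ∷ -[1+ 0 ] ∷ + 0 ∷ + 1 ∷ + 2 ∷ []

Separable : Cell → Cell → Cell → Cell → Set
Separable a b c d = Any (λ f → SeparatedBy f a b c d) box

separable? : ∀ a b c d → Dec (Separable a b c d)
separable? a b c d = any? (λ f → f ·ᶜ a ⊔ f ·ᶜ b ℤ.<? f ·ᶜ c ⊓ f ·ᶜ d) box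

separable⇒disjoint : ∀ {a b c d} → Separable a b c d → ∀ p → OnSeg a b p → ¬ OnSeg c d p
separable⇒disjoint sep with satisfied sep
... | f , f-sep = separated⇒disjoint f f-sep

Advances : Cell → Cell → Cell → Set
Advances a b d = Any (λ f → AdvancesBy f a b d) box

advances? : ∀ a b d → Dec (Advances a b d)
advances? a b d = any? (λ f → (f ·ᶜ a ℤ.≤? f ·ᶜ b) ×-dec (f ·ᶜ b ℤ.<? f ·ᶜ d)) box

advances⇒meetOnlyAt : ∀ {a b d} → Advances a b d → ∀ p → OnSeg a b p → OnSeg b d p → p ≡ centre b
advances⇒meetOnlyAt adv with satisfied adv
... | f , f-adv = advancesBy⇒meetOnlyAt f f-adv

inBox? : ∀ a b c u → Dec (InBox a b c u)
inBox? a b c (x , y , z) = (x ℕ.<? a) ×-dec (y ℕ.<? b) ×-dec (z ℕ.<? c)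

∀<? : ∀ {P : ℕ → Set} → (∀ i → Dec (P i)) → ∀ n → Dec (∀ i → i ℕ.< n → P i)
∀<? P? n = map′ (λ all i i<n → all i<n) (λ all {i} → all i) (ℕ.allUpTo? P? n)

_!_ : List Cell → ℕ → Cell
[]       ! _     = 0 , 0 , 0
(u ∷ _)  ! zero  = u
(_ ∷ us) ! suc i = us ! i

CertifiedPath : ℕ → ℕ → ℕ → ℕ → (ℕ → Cell) → Set
CertifiedPath a b c L v =
  (∀ i → i ℕ.< suc L → InBox a b c (v i)) ×
  (∀ i → i ℕ.< suc L → ∀ j → j ℕ.< suc L → v i ≡ v j → i ≡ j) ×
  (∀ i → i ℕ.< L → KnightStep (v i) (v (suc i))) ×
  (∀ i → i ℕ.< L → suc i ℕ.< L → Advances (v i) (v (suc i)) (v (suc (suc i)))) ×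
  (∀ i → i ℕ.< L → ∀ j → j ℕ.< L → suc i ℕ.< j → Separable (v i) (v (suc i)) (v j) (v (suc j)))

certifiedPath? : ∀ a b c L v → Dec (CertifiedPath a b c L v)
certifiedPath? a b c L v =
  ∀<? (λ i → inBox? a b c (v i)) (suc L) ×-dec
  ∀<? (λ i → ∀<? (λ j → (v i ≟ᶜ v j) →-dec (i ℕ.≟ j)) (suc L)) (suc L) ×-dec
  ∀<? (λ i → knightStep? (v i) (v (suc i))) L ×-dec
  ∀<? (λ i → (suc i ℕ.<? L) →-dec advances? (v i) (v (suc i)) (v (suc (suc i)))) L ×-dec
  ∀<? (λ i → ∀<? (λ j → (suc i ℕ.<? j) →-dec separable? (v i) (v (suc i)) (v j) (v (suc j))) L) L

certifiedPath⇒isNCPath : ∀ {a b c L v} → CertifiedPath a b c L v → IsNCPath a b c L v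
certifiedPath⇒isNCPath {v = v} (inBox , injective , knight , advances , separable) =
    (λ i i≤L → inBox i (s≤s i≤L))
  , (λ i j i≤L j≤L → injective i (s≤s i≤L) j (s≤s j≤L))
  , (λ i i<L → knightStep⇒knightMove (v i) (v (suc i)) (knight i i<L))
  , (λ i 1+i<L → advances⇒meetOnlyAt (advances i (ℕ.<-trans (ℕ.n<1+n i) 1+i<L) 1+i<L))
  , (λ i j 1+i<j j<L →
       separable⇒disjoint (separable i (ℕ.<-trans (ℕ.n<1+n i) (ℕ.<-trans 1+i<j j<L)) j j<L 1+i<j))

ncPath : ∀ a b c L vs → {True (certifiedPath? a b c L (vs !_))} → NCPath a b c L
ncPath a b c L vs {ok} = (vs !_) , certifiedPath⇒isNCPath (toWitness ok)

CertifiedTour : ℕ → ℕ → ℕ → ℕ → (ℕ → Cell) → Set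
CertifiedTour a b c L v =
  (∀ i → i ℕ.< L → InBox a b c (v i)) ×
  (v L ≡ v 0) ×
  (∀ i → i ℕ.< L → ∀ j → j ℕ.< L → v i ≡ v j → i ≡ j) ×
  (∀ i → i ℕ.< L → KnightStep (v i) (v (suc i))) ×
  (∀ i → i ℕ.< L → ∀ j → j ℕ.< L → CycNext L i j → Advances (v i) (v (suc i)) (v (suc j))) ×
  (∀ i → i ℕ.< L → ∀ j → j ℕ.< L → i ≢ j → ¬ CycNext L i j → ¬ CycNext L j i →
     Separable (v i) (v (suc i)) (v j) (v (suc j)))

cycNext? : ∀ L i j → Dec (CycNext L i j)
cycNext? L i j = (suc i ℕ.≟ j) ⊎-dec ((suc i ℕ.≟ L) ×-dec (j ℕ.≟ 0))

certifiedTour? : ∀ a b c L v → Dec (CertifiedTour a b c L v)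
certifiedTour? a b c L v =
  ∀<? (λ i → inBox? a b c (v i)) L ×-dec
  (v L ≟ᶜ v 0) ×-dec
  ∀<? (λ i → ∀<? (λ j → (v i ≟ᶜ v j) →-dec (i ℕ.≟ j)) L) L ×-dec
  ∀<? (λ i → knightStep? (v i) (v (suc i))) L ×-dec
  ∀<? (λ i → ∀<? (λ j → cycNext? L i j →-dec advances? (v i) (v (suc i)) (v (suc j))) L) L ×-dec
  ∀<? (λ i → ∀<? (λ j → ¬? (i ℕ.≟ j) →-dec ¬? (cycNext? L i j) →-dec ¬? (cycNext? L j i) →-dec
                         separable? (v i) (v (suc i)) (v j) (v (suc j))) L) L

cycNext⇒shared : ∀ {L i j} (v : ℕ → Cell) → v L ≡ v 0 → CycNext L i j → v (suc i) ≡ v j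
cycNext⇒shared v _      (inj₁ refl)          = refl
cycNext⇒shared v closed (inj₂ (refl , refl)) = closed

certifiedTour⇒isNCTour : ∀ {a b c L v} → CertifiedTour a b c L v → IsNCTour a b c L v
certifiedTour⇒isNCTour {v = v} (inBox , closed , injective , knight , advances , separable) =
    inBox
  , closed
  , (λ i j i<L j<L → injective i i<L j j<L)
  , (λ i i<L → knightStep⇒knightMove (v i) (v (suc i)) (knight i i<L))
  , (λ i j i<L j<L next p p∈i p∈j → advances⇒meetOnlyAt (advances i i<L j j<L next) p p∈i
       (subst (λ w → OnSeg w (v (suc j)) p) (sym (cycNext⇒shared v closed next)) p∈j))
  , (λ i j i<L j<L i≢j ¬next ¬prev → separable⇒disjoint (separable i i<L j j<L i≢j ¬next ¬prev))

ncTour : ∀ a b c L vs → {True (certifiedTour? a b c L (vs !_))} → NCTour a b c L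
ncTour a b c L vs {ok} = (vs !_) , certifiedTour⇒isNCTour (toWitness ok)

tour₁ : List Cell
tour₁ = (1 , 0 , 0) ∷ (0 , 0 , 2) ∷ (0 , 1 , 0) ∷ (1 , 1 , 2) ∷ (1 , 0 , 0) ∷ []

tour₂ : List Cell
tour₂ = (0 , 0 , 1) ∷ (0 , 2 , 0) ∷ (1 , 0 , 0) ∷ (0 , 0 , 2) ∷ (1 , 2 , 2) ∷ (1 , 0 , 1) ∷
        (1 , 2 , 0) ∷ (0 , 2 , 2) ∷ (0 , 0 , 1) ∷ []

path₁ : List Cell
path₁ = (0 , 0 , 1) ∷ (1 , 0 , 3) ∷ (1 , 2 , 2) ∷ (1 , 0 , 1) ∷ (1 , 2 , 0) ∷ (1 , 3 , 2) ∷
        (1 , 1 , 1) ∷ (0 , 3 , 1) ∷ (1 , 3 , 3) ∷ (0 , 1 , 3) ∷ (0 , 2 , 1) ∷ (1 , 2 , 3) ∷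
        (0 , 0 , 3) ∷ (0 , 1 , 1) ∷ (0 , 3 , 0) ∷ []

path₂ : List Cell
path₂ = (2 , 0 , 3) ∷ (1 , 0 , 1) ∷ (0 , 0 , 3) ∷ (0 , 2 , 2) ∷ (2 , 2 , 1) ∷ (2 , 0 , 0) ∷
        (1 , 2 , 0) ∷ (0 , 0 , 0) ∷ (0 , 1 , 2) ∷ (1 , 1 , 0) ∷ (1 , 0 , 2) ∷ (1 , 2 , 1) ∷
        (2 , 0 , 1) ∷ (2 , 2 , 2) ∷ (0 , 2 , 3) ∷ (1 , 0 , 3) ∷ (2 , 2 , 3) ∷ (2 , 0 , 2) ∷
        (1 , 0 , 0) ∷ (0 , 0 , 2) ∷ (1 , 2 , 2) ∷ []

path₃ : List Cell
path₃ = (2 , 1 , 1) ∷ (1 , 1 , 3) ∷ (2 , 3 , 3) ∷ (2 , 1 , 2) ∷ (1 , 3 , 2) ∷ (0 , 3 , 0) ∷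
        (2 , 2 , 0) ∷ (2 , 0 , 1) ∷ (1 , 0 , 3) ∷ (0 , 0 , 1) ∷ (1 , 2 , 1) ∷ (0 , 2 , 3) ∷
        (0 , 1 , 1) ∷ (0 , 3 , 2) ∷ (0 , 2 , 0) ∷ (2 , 2 , 1) ∷ (1 , 0 , 1) ∷ (1 , 2 , 0) ∷
        (2 , 0 , 0) ∷ (1 , 0 , 2) ∷ (0 , 0 , 0) ∷ (0 , 2 , 1) ∷ (2 , 3 , 1) ∷ (1 , 3 , 3) ∷
        (0 , 1 , 3) ∷ (1 , 1 , 1) ∷ (1 , 2 , 3) ∷ (0 , 0 , 3) ∷ []

mainTheorem2 : NCTour 2 2 3 4 × NCTour 2 3 3 8 ×
               NCPath 2 4 4 14 × NCPath 3 3 4 20 × NCPath 3 4 4 27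
mainTheorem2 =
    ncTour 2 2 3 4 tour₁
  , ncTour 2 3 3 8 tour₂
  , ncPath 2 4 4 14 path₁
  , ncPath 3 3 4 20 path₂
  , ncPath 3 4 4 27 path₃
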